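{- Let $k$ be a positive integer and let $G$ be a simple graph of order $n$ with $e(G)\geq (k-1)n-(k^{2}-k-1)$ edges. If $G$ contains no path on $2k$ vertices as a subgraph, then there exists an induced subgraph $H$ of $G$ with minimum degree $\delta(H)\geq k-1$ and with $|V(H)|\geq n-(k^{2}-k-1)$.
   Context: $e(G)$ denotes the number of edges of $G$, and $\delta(H)$ the minimum degree of $H$. -}

module Defs where

open import Data.Nat using (ℕ; zero; suc; _+_; _≤_)
open import Data.Product using (Σ; _×_)
open import Data.Nat.Base using (_<ᵇ_)
open import Data.Bool using (Bool; true; false; if_then_else_; _∧_)
open import Data.Fin using (Fin; toℕ) renaming (zero to fz; suc to fs)
open import Data.Fin.Subset using (Subset; _∈_; ∣_∣)
open import Data.Vec using (lookup)
open import Function.Definitions using (Injective)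
open import Relation.Binary.PropositionalEquality using (_≡_)

record Graph (n : ℕ) : Set where
  field
    adj    : Fin n → Fin n → Bool
    sym    : ∀ i j → adj i j ≡ adj j i
    irrefl : ∀ i → adj i i ≡ false
open Graph public

count : ∀ {n} → (Fin n → Bool) → ℕ
count {zero}  p = 0
count {suc n} p = (if p fz then 1 else 0) + count (λ i → p (fs i))

sumFin : ∀ {n} → (Fin n → ℕ) → ℕ
sumFin {zero}  f = 0
sumFin {suc n} f = f fz + sumFin (λ i → f (fs i))

edges : ∀ {n} → Graph n → ℕ
edges G = sumFin (λ i → count (λ j → adj G i j ∧ (toℕ i <ᵇ toℕ j)))

HasPath : ∀ {n} → Graph n → ℕ → Set
HasPath {n} G m =
  Σ (Fin m → Fin n) λ f →
    Injective _≡_ _≡_ f ×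
    (∀ (i j : Fin m) → toℕ j ≡ suc (toℕ i) → adj G (f i) (f j) ≡ true)

degIn : ∀ {n} → Graph n → Subset n → Fin n → ℕ
degIn G S v = count (λ u → lookup S u ∧ adj G v u)

MinDegIn≥ : ∀ {n} → Graph n → Subset n → ℕ → Set
MinDegIn≥ {n} G S d = ∀ (v : Fin n) → v ∈ S → d ≤ degIn G S v

-- Delete vertices of degree at most k - 2 one at a time; the remaining induced subgraph H has
-- minimum degree at least k - 1, and each deletion loses at most k - 2 edges, so
-- e(G) ≤ e(H) + r (k - 2) for the r deleted vertices. Since G has no path on 2k vertices, the
-- Erdős–Gallai bound e(H) ≤ (k - 1) |V(H)| applies, and comparing with the hypothesis on e(G)
-- gives r ≤ k² - k - 1. Erdős–Gallai itself goes by induction on the vertex set: a vertex of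
-- degree at most k - 1 is deleted; otherwise Pósa's rotations grow a path until it has 2k vertices
-- or closes into a cycle spanning a union of components with fewer than 2k vertices, which is
-- split off. For k = 1 the hypothesis demands an edge, i.e. a path on two vertices.
module Submission where

open import Defs renaming (sym to adj-sym)
open import Data.Nat using (ℕ; zero; suc; _+_; _*_; _∸_; _≤_; _<_; z≤n; s≤s; _≤?_; _<ᵇ_)
open import Data.Nat.Properties hiding (_≟_)
open import Data.Nat.Tactic.RingSolver using (solve-∀)
open import Data.Bool using (Bool; true; false; if_then_else_; _∧_; not)
open import Data.Bool.Properties using (∧-assoc; ∧-zeroʳ; ∧-identityʳ; ∧-conicalˡ; ∧-conicalʳ)
open import Data.Fin using (Fin; toℕ; _≟_) renaming (zero to fz; suc to fs)
open import Data.Fin.Properties using (toℕ-injective; any?)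
import Data.Bool as Bool
import Data.Nat as ℕ
open import Data.List using (List; []; _∷_; _++_; _ʳ++_; [_]; length; lookup; reverse)
open import Data.List.Properties using (++-assoc; ++-identityʳ; ʳ++-defn)
open import Data.List.Relation.Unary.Linked as Linked using (Linked; []; [-]; _∷_)
open import Data.Product using (Σ; _×_; _,_; proj₁; proj₂; ∃)
open import Data.Sum using (_⊎_; inj₁; inj₂)
open import Data.Empty using (⊥-elim)
open import Function using (_∘_; _$_)
open import Relation.Nullary using (¬_; Dec; yes; no; does)
open import Relation.Nullary.Decidable using (_×-dec_; dec-true)
open import Relation.Binary.Core using (Rel)
open import Relation.Binary.Definitions using (Symmetric)
open import Relation.Binary.PropositionalEquality hiding ([_])
open import Algebra.Properties.CommutativeSemigroup +-commutativeSemigroup using (x∙yz≈y∙xz; interchange)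
import Algebra.Properties.CommutativeMonoid.Sum +-0-commutativeMonoid as ∑
open import Data.Nat.Induction using (<-wellFounded)
import Induction.WellFounded as WF
import Relation.Binary.Construct.On as On
open import Data.Fin.Subset using (Subset; ∣_∣) renaming (_∈_ to _∈ₛ_)
open import Data.Vec using (tabulate)
open import Data.Vec.Properties using (lookup∘tabulate; []=⇒lookup)
open import Data.Integer as ℤ using (ℤ)
import Data.Integer.Properties as ℤₚ
import Data.Integer.Tactic.RingSolver as ℤ-Solver

indicator : Bool → ℕ
indicator b = if b then 1 else 0

indicator-∧-false : ∀ a b → a ∧ b ≡ false → indicator a + indicator b ≤ 1
indicator-∧-false true  false _ = ≤-refl
indicator-∧-false false true  _ = ≤-refl
indicator-∧-false false false _ = z≤n

<ᵇ-trichotomy : ∀ {m n} → m ≢ n → indicator (m <ᵇ n) + indicator (n <ᵇ m) ≡ 1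
<ᵇ-trichotomy {zero}  {zero}  m≢n = ⊥-elim (m≢n refl)
<ᵇ-trichotomy {zero}  {suc n} m≢n = refl
<ᵇ-trichotomy {suc m} {zero}  m≢n = refl
<ᵇ-trichotomy {suc m} {suc n} m≢n = <ᵇ-trichotomy (m≢n ∘ cong suc)

sumFin≡sum : ∀ {n} (f : Fin n → ℕ) → sumFin f ≡ ∑.sum f
sumFin≡sum {zero}  f = refl
sumFin≡sum {suc n} f = cong (f fz +_) (sumFin≡sum (λ i → f (fs i)))

sumFin-cong : ∀ {n} {f g : Fin n → ℕ} → (∀ i → f i ≡ g i) → sumFin f ≡ sumFin g
sumFin-cong {zero}  f≗g = refl
sumFin-cong {suc n} f≗g = cong₂ _+_ (f≗g fz) (sumFin-cong (λ i → f≗g (fs i)))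

sumFin-mono : ∀ {n} {f g : Fin n → ℕ} → (∀ i → f i ≤ g i) → sumFin f ≤ sumFin g
sumFin-mono {zero}  f≤g = z≤n
sumFin-mono {suc n} f≤g = +-mono-≤ (f≤g fz) (sumFin-mono (λ i → f≤g (fs i)))

sumFin-distrib-+ : ∀ {n} (f g : Fin n → ℕ) → sumFin (λ i → f i + g i) ≡ sumFin f + sumFin g
sumFin-distrib-+ {n} f g = begin
  sumFin (λ i → f i + g i)  ≡⟨ sumFin≡sum {n} _ ⟩
  ∑.sum (λ i → f i + g i)   ≡⟨ ∑.∑-distrib-+ f g ⟩
  ∑.sum f + ∑.sum g         ≡⟨ sym (cong₂ _+_ (sumFin≡sum f) (sumFin≡sum g)) ⟩
  sumFin f + sumFin g       ∎
  where open ≡-Reasoning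

sumFin-comm : ∀ {m n} (f : Fin m → Fin n → ℕ) →
  sumFin (λ i → sumFin (λ j → f i j)) ≡ sumFin (λ j → sumFin (λ i → f i j))
sumFin-comm {m} {n} f = begin
  sumFin (λ i → sumFin (λ j → f i j))  ≡⟨ trans (sumFin-cong (λ i → sumFin≡sum (f i))) (sumFin≡sum {m} _) ⟩
  ∑.sum (λ i → ∑.sum (λ j → f i j))    ≡⟨ ∑.∑-comm f ⟩
  ∑.sum (λ j → ∑.sum (λ i → f i j))
    ≡⟨ sym (trans (sumFin-cong (λ j → sumFin≡sum (λ i → f i j))) (sumFin≡sum {n} _)) ⟩
  sumFin (λ j → sumFin (λ i → f i j))  ∎
  where open ≡-Reasoning

sumFin-if : ∀ {n} (p : Fin n → Bool) (c : ℕ) → sumFin (λ i → if p i then c else 0) ≡ count p * c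
sumFin-if {zero}  p c = refl
sumFin-if {suc n} p c with p fz
... | true  = cong (c +_) (sumFin-if (λ i → p (fs i)) c)
... | false = sumFin-if (λ i → p (fs i)) c

sumFin-zero : ∀ n → sumFin {n} (λ _ → 0) ≡ 0
sumFin-zero zero    = refl
sumFin-zero (suc n) = sumFin-zero n

sumFin-point : ∀ {n} (f : Fin n → ℕ) (v : Fin n) →
  sumFin (λ u → if does (u ≟ v) then f u else 0) ≡ f v
sumFin-point {suc n} f fz     = trans (cong (f fz +_) (sumFin-zero n)) (+-identityʳ (f fz))
sumFin-point {suc n} f (fs v) = sumFin-point (λ i → f (fs i)) v

count≡sumFin : ∀ {n} (p : Fin n → Bool) → count p ≡ sumFin (λ i → indicator (p i))
count≡sumFin {zero}  p = refl
count≡sumFin {suc n} p = cong (indicator (p fz) +_) (count≡sumFin (λ i → p (fs i)))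

count-cong : ∀ {n} {p q : Fin n → Bool} → (∀ i → p i ≡ q i) → count p ≡ count q
count-cong {zero}  p≗q = refl
count-cong {suc n} p≗q = cong₂ _+_ (cong indicator (p≗q fz)) (count-cong (λ i → p≗q (fs i)))

count-mono : ∀ {n} {p q : Fin n → Bool} → (∀ i → p i ≡ true → q i ≡ true) → count p ≤ count q
count-mono {zero}  p⇒q = z≤n
count-mono {suc n} {p} {q} p⇒q = +-mono-≤ head (count-mono (λ i → p⇒q (fs i)))
  where
  head : indicator (p fz) ≤ indicator (q fz)
  head with p fz in eq
  ... | true  rewrite p⇒q fz eq = ≤-refl
  ... | false = z≤n

count-all : ∀ {n} → count {n} (λ _ → true) ≡ n
count-all {zero}  = refl
count-all {suc n} = cong suc (count-all {n})

-- The guard comes first so that `delete P v u` reduces to `P u` as soon as u ≟ v is decided negatively.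
delete : ∀ {n} → (Fin n → Bool) → Fin n → Fin n → Bool
delete P v u = not (does (u ≟ v)) ∧ P u

_∖_ : ∀ {n} → (Fin n → Bool) → (Fin n → Bool) → Fin n → Bool
(P ∖ T) u = not (T u) ∧ P u

count-delete : ∀ {n} (p : Fin n → Bool) (v : Fin n) →
  count p ≡ indicator (p v) + count (delete p v)
count-delete {suc n} p fz     = refl
count-delete {suc n} p (fs v) =
  trans (cong (indicator (p fz) +_) (count-delete (λ i → p (fs i)) v))
        (x∙yz≈y∙xz (indicator (p fz)) (indicator (p (fs v))) _)

count-delete-∈ : ∀ {n} (P : Fin n → Bool) v → P v ≡ true → count P ≡ suc (count (delete P v))
count-delete-∈ P v Pv = trans (count-delete P v) (cong (λ b → indicator b + count (delete P v)) Pv)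

count-induction : ∀ {n} (Goal : (Fin n → Bool) → Set) →
  (∀ P → (∀ {Q} → count Q < count P → Goal Q) → Goal P) → ∀ P → Goal P
count-induction Goal = WF.All.wfRec (On.wellFounded count <-wellFounded) _ Goal

count-∖ : ∀ {n} {P T : Fin n → Bool} → (∀ u → T u ≡ true → P u ≡ true) →
  count P ≡ count T + count (P ∖ T)
count-∖ {zero}        T⊆P = refl
count-∖ {suc n} {P} {T} T⊆P =
  trans (cong₂ _+_ head (count-∖ (λ u → T⊆P (fs u))))
        (interchange (indicator (T fz)) (indicator (not (T fz) ∧ P fz)) _ _)
  where
  head : indicator (P fz) ≡ indicator (T fz) + indicator (not (T fz) ∧ P fz)
  head with T fz in eq
  ... | true  rewrite T⊆P fz eq = refl
  ... | false = refl

module _ {A : Set} where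

  countᴸ : (A → Bool) → List A → ℕ
  countᴸ Q []       = 0
  countᴸ Q (x ∷ xs) = indicator (Q x) + countᴸ Q xs

  countᴸ-++ : ∀ Q xs ys → countᴸ Q (xs ++ ys) ≡ countᴸ Q xs + countᴸ Q ys
  countᴸ-++ Q []       ys = refl
  countᴸ-++ Q (x ∷ xs) ys = trans (cong (indicator (Q x) +_) (countᴸ-++ Q xs ys))
                                  (sym (+-assoc (indicator (Q x)) (countᴸ Q xs) (countᴸ Q ys)))

  countᴸ-ʳ++ : ∀ Q xs ys → countᴸ Q (xs ʳ++ ys) ≡ countᴸ Q xs + countᴸ Q ys
  countᴸ-ʳ++ Q []       ys = refl
  countᴸ-ʳ++ Q (x ∷ xs) ys = trans (countᴸ-ʳ++ Q xs (x ∷ ys)) $ begin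
    countᴸ Q xs + (indicator (Q x) + countᴸ Q ys)
      ≡⟨ x∙yz≈y∙xz (countᴸ Q xs) (indicator (Q x)) (countᴸ Q ys) ⟩
    indicator (Q x) + (countᴸ Q xs + countᴸ Q ys)
      ≡⟨ +-assoc (indicator (Q x)) (countᴸ Q xs) (countᴸ Q ys) ⟨
    indicator (Q x) + countᴸ Q xs + countᴸ Q ys    ∎
    where open ≡-Reasoning

  countᴸ-mono : ∀ {Q R} xs → (∀ x → Q x ≡ true → R x ≡ true) → countᴸ Q xs ≤ countᴸ R xs
  countᴸ-mono         []       Q⇒R = z≤n
  countᴸ-mono {Q} {R} (x ∷ xs) Q⇒R = +-mono-≤ head (countᴸ-mono xs Q⇒R)
    where
    head : indicator (Q x) ≤ indicator (R x)
    head with Q x in eq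
    ... | true  rewrite Q⇒R x eq = ≤-refl
    ... | false = z≤n

  ʳ++-assoc : ∀ (xs ys zs : List A) → (xs ʳ++ ys) ++ zs ≡ xs ʳ++ (ys ++ zs)
  ʳ++-assoc xs ys zs = begin
    (xs ʳ++ ys) ++ zs         ≡⟨ cong (_++ zs) (ʳ++-defn xs {ys}) ⟩
    (reverse xs ++ ys) ++ zs  ≡⟨ ++-assoc (reverse xs) ys zs ⟩
    reverse xs ++ ys ++ zs    ≡⟨ ʳ++-defn xs {ys ++ zs} ⟨
    xs ʳ++ (ys ++ zs)         ∎
    where open ≡-Reasoning

  lastOf : A → List A → A
  lastOf x []       = x
  lastOf x (y ∷ ys) = lastOf y ys

  lastOf-++ : ∀ x xs y ys → lastOf x (xs ++ y ∷ ys) ≡ lastOf y ys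
  lastOf-++ x []       y ys = refl
  lastOf-++ x (z ∷ xs) y ys = lastOf-++ z xs y ys

  ʳ++-head : ∀ x xs ys → Σ (List A) λ zs → xs ʳ++ x ∷ ys ≡ lastOf x xs ∷ zs
  ʳ++-head x []       ys = ys , refl
  ʳ++-head x (y ∷ xs) ys = ʳ++-head y xs (x ∷ ys)

  -- If no entry satisfying Q₁ is followed by one satisfying Q₂, the Q₁-entries other than the last
  -- and the Q₂-entries other than the first mark disjoint sets among the length xs consecutive pairs.
  consecutive-or-countᴸ≤ : ∀ (Q₁ Q₂ : A → Bool) x xs →
    (Σ (List A) λ s → Σ A λ b → Σ (List A) λ t →
       xs ≡ s ++ b ∷ t × Q₁ (lastOf x s) ≡ true × Q₂ b ≡ true)
    ⊎ countᴸ Q₁ (x ∷ xs) + countᴸ Q₂ (x ∷ xs) ≤ length xs + indicator (Q₂ x) + indicator (Q₁ (lastOf x xs))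
  consecutive-or-countᴸ≤ Q₁ Q₂ x [] = inj₂ (≤-reflexive (swap (indicator (Q₁ x)) (indicator (Q₂ x))))
    where
    swap : ∀ a b → (a + 0) + (b + 0) ≡ 0 + b + a
    swap = solve-∀
  consecutive-or-countᴸ≤ Q₁ Q₂ x (y ∷ ys) with consecutive-or-countᴸ≤ Q₁ Q₂ y ys
  ... | inj₁ (s , b , t , eq , q₁ , q₂) = inj₁ (y ∷ s , b , t , cong (y ∷_) eq , q₁ , q₂)
  ... | inj₂ ih with Q₁ x ∧ Q₂ y in both
  ...   | true  = inj₁ ([] , y , ys , refl , ∧-conicalˡ _ _ both , ∧-conicalʳ _ _ both)
  ...   | false = inj₂ (shift (indicator (Q₁ x)) (indicator (Q₂ y)) (indicator (Q₂ x))
                              (countᴸ Q₁ (y ∷ ys)) (countᴸ Q₂ ys) (length ys)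
                              (indicator (Q₁ (lastOf y ys))) (indicator-∧-false (Q₁ x) (Q₂ y) both) ih)
    where
    shift : ∀ a b c S₁ S₂ l L → a + b ≤ 1 → S₁ + (b + S₂) ≤ l + b + L →
      (a + S₁) + (c + (b + S₂)) ≤ suc l + c + L
    shift a b c S₁ S₂ l L a+b≤1 ih = begin
      (a + S₁) + (c + (b + S₂))  ≡⟨ regroup₁ a S₁ c (b + S₂) ⟩
      (a + c) + (S₁ + (b + S₂))  ≤⟨ +-monoʳ-≤ (a + c) ih ⟩
      (a + c) + (l + b + L)      ≡⟨ regroup₂ a b c l L ⟩
      (a + b) + (l + c + L)      ≤⟨ +-monoˡ-≤ (l + c + L) a+b≤1 ⟩
      suc l + c + L              ∎
      where
      open ≤-Reasoning
      regroup₁ : ∀ a S c T → (a + S) + (c + T) ≡ (a + c) + (S + T)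
      regroup₁ = solve-∀
      regroup₂ : ∀ a b c l L → (a + c) + (l + b + L) ≡ (a + b) + (l + c + L)
      regroup₂ = solve-∀

  module _ {ℓ} {R : Rel A ℓ} where

    Linked-lookup : ∀ {xs} → Linked R xs → ∀ i j → toℕ j ≡ suc (toℕ i) → R (lookup xs i) (lookup xs j)
    Linked-lookup (r ∷ _)   fz     (fs fz) refl = r
    Linked-lookup (_ ∷ rxs) (fs i) (fs j) j≡i+1 = Linked-lookup rxs i j (suc-injective j≡i+1)

    Linked-++⁻ˡ : ∀ xs {ys} → Linked R (xs ++ ys) → Linked R xs
    Linked-++⁻ˡ []           _         = []
    Linked-++⁻ˡ (x ∷ [])     _         = [-]
    Linked-++⁻ˡ (x ∷ y ∷ xs) (r ∷ rxs) = r ∷ Linked-++⁻ˡ (y ∷ xs) rxs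

    Linked-++⁻ʳ : ∀ xs {ys} → Linked R (xs ++ ys) → Linked R ys
    Linked-++⁻ʳ []           rys      = rys
    Linked-++⁻ʳ (x ∷ xs)     rxs      = Linked-++⁻ʳ xs (Linked.tail rxs)

    Linked-++⁺ : ∀ {x xs y ys} → Linked R (x ∷ xs) → R (lastOf x xs) y → Linked R (y ∷ ys) →
      Linked R (x ∷ xs ++ y ∷ ys)
    Linked-++⁺ {xs = []}    [-]       r rys = r ∷ rys
    Linked-++⁺ {xs = _ ∷ _} (r′ ∷ rxs) r rys = r′ ∷ Linked-++⁺ rxs r rys

    Linked-join : ∀ xs {a ys} → Linked R (xs ++ [ a ]) → Linked R (a ∷ ys) → Linked R (xs ++ a ∷ ys)
    Linked-join []           _         rys = rys
    Linked-join (x ∷ [])     (r ∷ _)   rys = r ∷ rys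
    Linked-join (x ∷ y ∷ xs) (r ∷ rxs) rys = r ∷ Linked-join (y ∷ xs) rxs rys

    Linked-ʳ++ : Symmetric R → ∀ {x xs ys} → Linked R (x ∷ xs) → Linked R (x ∷ ys) →
      Linked R (xs ʳ++ x ∷ ys)
    Linked-ʳ++ sym-R {xs = []}    _         rys = rys
    Linked-ʳ++ sym-R {xs = _ ∷ _} (r ∷ rxs) rys = Linked-ʳ++ sym-R rxs (sym-R r ∷ rys)

    Linked-rotate : ∀ {x cs} As {z} Bs → Linked R (x ∷ cs ++ [ x ]) → x ∷ cs ≡ As ++ z ∷ Bs →
      Linked R (z ∷ Bs ++ As)
    Linked-rotate [] Bs cyc refl =
      subst (Linked R) (cong (_ ∷_) (sym (++-identityʳ Bs))) (Linked-++⁻ˡ (_ ∷ Bs) cyc)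
    Linked-rotate {x} (_ ∷ As) {z} Bs cyc refl =
      Linked-join (z ∷ Bs) (Linked-++⁻ʳ (x ∷ As) cyc′) (Linked-++⁻ˡ (x ∷ As) cyc′)
      where
      cyc′ : Linked R (x ∷ As ++ z ∷ Bs ++ [ x ])
      cyc′ = subst (Linked R) (cong (x ∷_) (++-assoc As (z ∷ Bs) [ x ])) cyc

-- Vertex lists as multisets

module _ {n : ℕ} where

  mult : Fin n → List (Fin n) → ℕ
  mult w = countᴸ (λ x → does (w ≟ x))

  _≋_ : List (Fin n) → List (Fin n) → Set
  xs ≋ ys = ∀ w → mult w xs ≡ mult w ys

  Distinct : List (Fin n) → Set
  Distinct xs = ∀ w → mult w xs ≤ 1

  ʳ++-≋ : ∀ xs ys → (xs ʳ++ ys) ≋ (ys ++ xs)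
  ʳ++-≋ xs ys w = trans (countᴸ-ʳ++ _ xs ys) (trans (+-comm (mult w xs) _) (sym (countᴸ-++ _ ys xs)))

  ++-comm-≋ : ∀ xs ys → (xs ++ ys) ≋ (ys ++ xs)
  ++-comm-≋ xs ys w = trans (countᴸ-++ _ xs ys) (trans (+-comm (mult w xs) _) (sym (countᴸ-++ _ ys xs)))

  ++⁺-≋ : ∀ xs {ys zs} → ys ≋ zs → (xs ++ ys) ≋ (xs ++ zs)
  ++⁺-≋ xs {ys} {zs} ys≋zs w =
    trans (countᴸ-++ _ xs ys) (trans (cong (mult w xs +_) (ys≋zs w)) (sym (countᴸ-++ _ xs zs)))

  support : List (Fin n) → Fin n → Bool
  support xs w = 0 <ᵇ mult w xs

  support⇒mult : ∀ xs u → support xs u ≡ true → 1 ≤ mult u xs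
  support⇒mult xs u u∈ with mult u xs
  ... | suc _ = s≤s z≤n

  mult⇒support : ∀ xs u → 1 ≤ mult u xs → support xs u ≡ true
  mult⇒support xs u u∈ with mult u xs | u∈
  ... | suc _ | _ = refl

  mult-head : ∀ x xs → 1 ≤ mult x (x ∷ xs)
  mult-head x xs rewrite dec-true (x ≟ x) refl = s≤s z≤n

  mult-lastOf : ∀ x xs → 1 ≤ mult (lastOf x xs) (x ∷ xs)
  mult-lastOf x []       = mult-head x []
  mult-lastOf x (y ∷ xs) = ≤-trans (mult-lastOf y xs) (m≤n+m _ (indicator (does (lastOf y xs ≟ x))))

  mult-split : ∀ z xs → 1 ≤ mult z xs → Σ (List (Fin n)) λ As → Σ (List (Fin n)) λ Bs → xs ≡ As ++ z ∷ Bs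
  mult-split z (x ∷ xs) z∈ with z ≟ x
  ... | yes refl = [] , xs , refl
  ... | no  _    with mult-split z xs z∈
  ...   | As , Bs , refl = x ∷ As , Bs , refl

  Distinct-∷ : ∀ {y xs} → mult y xs ≡ 0 → Distinct xs → Distinct (y ∷ xs)
  Distinct-∷ {y} y∉ distinct w with w ≟ y
  ... | yes refl rewrite y∉ = s≤s z≤n
  ... | no  _    = distinct w

  sumFin-mult : ∀ xs → sumFin (λ u → mult u xs) ≡ length xs
  sumFin-mult []       = sumFin-zero n
  sumFin-mult (x ∷ xs) = trans (sumFin-distrib-+ (λ u → indicator (does (u ≟ x))) (λ u → mult u xs))
                               (cong₂ _+_ (sumFin-point (λ _ → 1) x) (sumFin-mult xs))

  ≋-length : ∀ {xs ys} → xs ≋ ys → length xs ≡ length ys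
  ≋-length {xs} {ys} xs≋ys = trans (sym (sumFin-mult xs)) (trans (sumFin-cong xs≋ys) (sumFin-mult ys))

  count-support : ∀ xs → Distinct xs → count (support xs) ≡ length xs
  count-support xs distinct = trans (count≡sumFin (support xs)) (trans (sumFin-cong one) (sumFin-mult xs))
    where
    one : ∀ u → indicator (support xs u) ≡ mult u xs
    one u with mult u xs | distinct u
    ... | zero  | _       = refl
    ... | suc _ | s≤s z≤n = refl

  sumFin-if-mult : ∀ (Q : Fin n → Bool) xs → sumFin (λ u → if Q u then mult u xs else 0) ≡ countᴸ Q xs
  sumFin-if-mult Q []       = trans (sumFin-if Q 0) (*-zeroʳ (count Q))
  sumFin-if-mult Q (x ∷ xs) = trans (sumFin-cong split) $
    trans (sumFin-distrib-+ (λ u → if does (u ≟ x) then indicator (Q u) else 0)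
                            (λ u → if Q u then mult u xs else 0)) $
    cong₂ _+_ (sumFin-point (λ u → indicator (Q u)) x) (sumFin-if-mult Q xs)
    where
    split : ∀ u → (if Q u then mult u (x ∷ xs) else 0)
                ≡ (if does (u ≟ x) then indicator (Q u) else 0) + (if Q u then mult u xs else 0)
    split u with Q u | u ≟ x
    ... | true  | yes _ = refl
    ... | true  | no  _ = refl
    ... | false | yes _ = refl
    ... | false | no  _ = refl

  count≤countᴸ : ∀ (Q : Fin n → Bool) xs → (∀ u → Q u ≡ true → 1 ≤ mult u xs) → count Q ≤ countᴸ Q xs
  count≤countᴸ Q xs Q⊆xs = begin
    count Q                                          ≡⟨ count≡sumFin Q ⟩
    sumFin (λ u → indicator (Q u))                   ≤⟨ sumFin-mono bound ⟩
    sumFin (λ u → if Q u then mult u xs else 0)      ≡⟨ sumFin-if-mult Q xs ⟩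
    countᴸ Q xs                                      ∎
    where
    open ≤-Reasoning
    bound : ∀ u → indicator (Q u) ≤ (if Q u then mult u xs else 0)
    bound u with Q u in Qu
    ... | true  = Q⊆xs u Qu
    ... | false = z≤n

  Distinct⇒head∉tail : ∀ {x xs} → Distinct (x ∷ xs) → ¬ 1 ≤ mult x xs
  Distinct⇒head∉tail {x} {xs} distinct x∈ =
    1+n≰n (≤-trans (s≤s x∈)
                   (subst (λ b → indicator b + mult x xs ≤ 1) (dec-true (x ≟ x) refl) (distinct x)))

  lookup-mult : ∀ xs i → 1 ≤ mult (lookup xs i) xs
  lookup-mult (x ∷ xs) fz     = mult-head x xs
  lookup-mult (x ∷ xs) (fs i) = ≤-trans (lookup-mult xs i) (m≤n+m _ (indicator (does (lookup xs i ≟ x))))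

  lookup-injective : ∀ xs → Distinct xs → ∀ {i j} → lookup xs i ≡ lookup xs j → i ≡ j
  lookup-injective (x ∷ xs) distinct {fz}   {fz}   _  = refl
  lookup-injective (x ∷ xs) distinct {fz}   {fs j} eq =
    ⊥-elim (Distinct⇒head∉tail {x = x} {xs} distinct
                                (subst (λ y → 1 ≤ mult y xs) (sym eq) (lookup-mult xs j)))
  lookup-injective (x ∷ xs) distinct {fs i} {fz}   eq =
    ⊥-elim (Distinct⇒head∉tail {x = x} {xs} distinct
                                (subst (λ y → 1 ≤ mult y xs) eq (lookup-mult xs i)))
  lookup-injective (x ∷ xs) distinct {fs i} {fs j} eq =
    cong fs (lookup-injective xs (λ w → ≤-trans (m≤n+m _ (indicator (does (w ≟ x)))) (distinct w)) eq)

module _ {n : ℕ} (G : Graph n) where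

  Adj : Fin n → Fin n → Set
  Adj u w = adj G u w ≡ true

  Adj-sym : Symmetric Adj
  Adj-sym {u} {w} uw = trans (adj-sym G w u) uw

  deg : (Fin n → Bool) → Fin n → ℕ
  deg P u = count (λ w → P w ∧ adj G u w)

  degOn : (Fin n → Bool) → Fin n → ℕ
  degOn P u = if P u then deg P u else 0

  degreeSum : (Fin n → Bool) → ℕ
  degreeSum P = sumFin (degOn P)

  deg-delete : ∀ P v u → deg P u ≡ indicator (P v ∧ adj G u v) + deg (delete P v) u
  deg-delete P v u =
    trans (count-delete (λ w → P w ∧ adj G u w) v)
          (cong (_ +_) (count-cong (λ w → sym (∧-assoc (not (does (w ≟ v))) (P w) (adj G u w)))))

  deg-delete-self : ∀ P v → deg (delete P v) v ≡ deg P v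
  deg-delete-self P v rewrite deg-delete P v v | irrefl G v | ∧-zeroʳ (P v) = refl

  degreeSum-delete : ∀ P v → P v ≡ true → degreeSum P ≡ degreeSum (delete P v) + 2 * deg P v
  degreeSum-delete P v Pv = begin
    degreeSum P
      ≡⟨ sumFin-cong split ⟩
    sumFin (λ u → degOn P′ u + at-v u + edge-to-v u)
      ≡⟨ sumFin-distrib-+ (λ u → degOn P′ u + at-v u) edge-to-v ⟩
    sumFin (λ u → degOn P′ u + at-v u) + sumFin edge-to-v
      ≡⟨ cong₂ _+_ (sumFin-distrib-+ (degOn P′) at-v) (sym (count≡sumFin (λ u → P′ u ∧ adj G v u))) ⟩
    degreeSum P′ + sumFin at-v + deg P′ v
      ≡⟨ cong₂ (λ a b → degreeSum P′ + a + b) (sumFin-point (λ _ → deg P v) v) (deg-delete-self P v) ⟩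
    degreeSum P′ + deg P v + deg P v
      ≡⟨ +-assoc (degreeSum P′) _ _ ⟩
    degreeSum P′ + (deg P v + deg P v)
      ≡⟨ cong (λ m → degreeSum P′ + (deg P v + m)) (+-identityʳ (deg P v)) ⟨
    degreeSum P′ + 2 * deg P v ∎
    where
    open ≡-Reasoning
    P′ = delete P v
    at-v edge-to-v : Fin n → ℕ
    at-v u = if does (u ≟ v) then deg P v else 0
    edge-to-v u = indicator (P′ u ∧ adj G v u)
    split : ∀ u → degOn P u ≡ degOn P′ u + at-v u + edge-to-v u
    split u with u ≟ v
    ... | yes refl rewrite Pv = sym (+-identityʳ (deg P u))
    ... | no  u≢v with P u
    ...   | false = refl
    ...   | true  rewrite deg-delete P v u | Pv | adj-sym G u v =
      trans (+-comm (indicator (adj G v u)) _)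
            (cong (_+ indicator (adj G v u)) (sym (+-identityʳ (deg P′ u))))

  degreeSum-delete≤ : ∀ P v c → P v ≡ true → deg P v ≤ c → degreeSum P ≤ degreeSum (delete P v) + 2 * c
  degreeSum-delete≤ P v c Pv low =
    ≤-trans (≤-reflexive (degreeSum-delete P v Pv)) (+-monoʳ-≤ (degreeSum (delete P v)) (*-monoʳ-≤ 2 low))

  handshake : edges G + edges G ≡ degreeSum (λ _ → true)
  handshake = begin
    edges G + edges G
      ≡⟨ cong₂ _+_ rows (trans rows (sumFin-comm below)) ⟩
    sumFin (λ i → sumFin (below i)) + sumFin (λ i → sumFin (λ j → below j i))
      ≡⟨ sym (sumFin-distrib-+ (λ i → sumFin (below i)) _) ⟩
    sumFin (λ i → sumFin (below i) + sumFin (λ j → below j i))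
      ≡⟨ sumFin-cong (λ i → sym (sumFin-distrib-+ (below i) _)) ⟩
    sumFin (λ i → sumFin (λ j → below i j + below j i))
      ≡⟨ sumFin-cong (λ i → sumFin-cong (edge-counted-once i)) ⟩
    sumFin (λ i → sumFin (λ j → indicator (adj G i j)))
      ≡⟨ sumFin-cong (λ i → sym (count≡sumFin (adj G i))) ⟩
    degreeSum (λ _ → true) ∎
    where
    open ≡-Reasoning
    below : Fin n → Fin n → ℕ
    below i j = indicator (adj G i j ∧ (toℕ i <ᵇ toℕ j))
    rows : edges G ≡ sumFin (λ i → sumFin (below i))
    rows = sumFin-cong (λ i → count≡sumFin (λ j → adj G i j ∧ (toℕ i <ᵇ toℕ j)))
    edge-counted-once : ∀ i j → below i j + below j i ≡ indicator (adj G i j)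
    edge-counted-once i j rewrite adj-sym G j i with adj G i j in ij
    ... | false = refl
    ... | true  = <ᵇ-trichotomy (λ i≡j → loop (toℕ-injective i≡j))
      where
      loop : i ≢ j
      loop refl with () ← trans (sym ij) (irrefl G i)

  record ClosedIn (P T : Fin n → Bool) : Set where
    field
      ⊆P     : ∀ u → T u ≡ true → P u ≡ true
      closed : ∀ u w → T u ≡ true → P w ≡ true → Adj u w → T w ≡ true

  module _ {P T : Fin n → Bool} (T-closed : ClosedIn P T) where
    open ClosedIn T-closed

    deg-inside : ∀ u → T u ≡ true → deg P u ≡ deg T u
    deg-inside u Tu = count-cong same
      where
      same : ∀ w → (P w ∧ adj G u w) ≡ (T w ∧ adj G u w)
      same w with adj G u w in uw
      ... | false = trans (∧-zeroʳ (P w)) (sym (∧-zeroʳ (T w)))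
      ... | true with T w in Tw
      ...   | true  = trans (∧-identityʳ (P w)) (⊆P w Tw)
      ...   | false with P w in Pw
      ...     | false = refl
      ...     | true with () ← trans (sym (closed u w Tu Pw uw)) Tw

    deg-outside : ∀ u → P u ≡ true → T u ≡ false → deg P u ≡ deg (P ∖ T) u
    deg-outside u Pu Tu = count-cong same
      where
      same : ∀ w → (P w ∧ adj G u w) ≡ ((not (T w) ∧ P w) ∧ adj G u w)
      same w with adj G u w in uw
      ... | false = trans (∧-zeroʳ (P w)) (sym (∧-zeroʳ _))
      ... | true with T w in Tw
      ...   | false = refl
      ...   | true with () ← trans (sym (closed w u Tw Pu (Adj-sym uw))) Tu

    degreeSum-split : degreeSum P ≡ degreeSum T + degreeSum (P ∖ T)
    degreeSum-split = trans (sumFin-cong split) (sumFin-distrib-+ (degOn T) (degOn (P ∖ T)))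
      where
      split : ∀ u → degOn P u ≡ degOn T u + degOn (P ∖ T) u
      split u with T u in Tu
      ... | true rewrite ⊆P u Tu = trans (deg-inside u Tu) (sym (+-identityʳ _))
      ... | false with P u in Pu
      ...   | true  = deg-outside u Pu Tu
      ...   | false = refl

  deg<count : ∀ T v → T v ≡ true → deg T v < count T
  deg<count T v Tv = begin-strict
    deg T v                 ≡⟨ sym (deg-delete-self T v) ⟩
    deg (delete T v) v                   ≤⟨ count-mono {q = delete T v} (λ w → ∧-conicalˡ _ _) ⟩
    count (delete T v)                   <⟨ n<1+n _ ⟩
    indicator true + count (delete T v)  ≡⟨ cong (λ b → indicator b + count (delete T v)) (sym Tv) ⟩
    indicator (T v) + count (delete T v) ≡⟨ sym (count-delete T v) ⟩
    count T                              ∎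
    where open ≤-Reasoning

  degreeSum≤ : ∀ T c → (∀ v → T v ≡ true → deg T v ≤ c) → degreeSum T ≤ count T * c
  degreeSum≤ T c deg≤c = ≤-trans (sumFin-mono bound) (≤-reflexive (sumFin-if T c))
    where
    bound : ∀ v → degOn T v ≤ (if T v then c else 0)
    bound v with T v in Tv
    ... | true  = deg≤c v Tv
    ... | false = z≤n

  Linked⇒HasPath : ∀ {xs} → Linked Adj xs → Distinct xs → HasPath G (length xs)
  Linked⇒HasPath {xs} walk distinct = lookup xs , lookup-injective xs distinct , Linked-lookup walk

  record SmallClosedSet (P : Fin n → Bool) (m : ℕ) : Set where
    field
      set      : Fin n → Bool
      nonempty : 1 ≤ count set
      small    : count set < m
      closedIn : ClosedIn P set

-- Growing paths

module Pósa {n : ℕ} (G : Graph n) (P : Fin n → Bool) where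

  record IsPathIn (xs : List (Fin n)) : Set where
    field
      walk     : Linked (Adj G) xs
      distinct : Distinct xs
      inside   : ∀ w → 1 ≤ mult w xs → P w ≡ true
  open IsPathIn

  IsPathIn-[] : IsPathIn []
  IsPathIn-[] = record { walk = [] ; distinct = λ _ → z≤n ; inside = λ _ () }

  IsPathIn-∷ : ∀ {y xs} → P y ≡ true → mult y xs ≡ 0 → Linked (Adj G) (y ∷ xs) → IsPathIn xs →
    IsPathIn (y ∷ xs)
  IsPathIn-∷ {y} {xs} Py y∉ walk p = record
    { walk = walk ; distinct = Distinct-∷ {xs = xs} y∉ (distinct p) ; inside = inside′ }
    where
    inside′ : ∀ w → 1 ≤ mult w (y ∷ xs) → P w ≡ true
    inside′ w w∈ with w ≟ y
    ... | yes refl = Py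
    ... | no  _    = inside p w w∈

  IsPathIn-≋ : ∀ {xs ys} → ys ≋ xs → Linked (Adj G) ys → IsPathIn xs → IsPathIn ys
  IsPathIn-≋ ys≋xs walk p = record
    { walk     = walk
    ; distinct = λ w → subst (_≤ 1) (sym (ys≋xs w)) (distinct p w)
    ; inside   = λ w w∈ → inside p w (subst (1 ≤_) (ys≋xs w) w∈)
    }

  CycleThrough : Fin n → List (Fin n) → Set
  CycleThrough x xs = Σ (List (Fin n)) λ cs → (x ∷ cs) ≋ (x ∷ xs) × Linked (Adj G) (x ∷ cs ++ [ x ])

  LongerPath : List (Fin n) → Set
  LongerPath xs = Σ (Fin n) λ y → Σ (List (Fin n)) λ ys → IsPathIn (y ∷ ys) × length ys ≡ length xs

  Escape : List (Fin n) → Fin n → Fin n → Set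
  Escape xs z y = 1 ≤ mult z xs × P y ≡ true × mult y xs ≡ 0 × Adj G z y

  escape? : ∀ xs z y → Dec (Escape xs z y)
  escape? xs z y =
    (1 ≤? mult z xs) ×-dec (P y Bool.≟ true) ×-dec (mult y xs ℕ.≟ 0) ×-dec (adj G z y Bool.≟ true)

  no-escape⇒on-list : ∀ {xs z} → ¬ ∃ (Escape xs z) → 1 ≤ mult z xs →
    ∀ y → P y ≡ true → Adj G z y → 1 ≤ mult y xs
  no-escape⇒on-list {xs} no-escape z∈ y Py zy with mult y xs in y∉
  ... | zero  = ⊥-elim (no-escape (y , z∈ , Py , y∉ , zy))
  ... | suc _ = s≤s z≤n

  escape⇒longer : ∀ {xs z zs y} → IsPathIn xs → (z ∷ zs) ≋ xs → Linked (Adj G) (z ∷ zs) → Escape xs z y →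
    LongerPath xs
  escape⇒longer {xs} {z} {zs} {y} p z∷zs≋xs walk (_ , Py , y∉ , zy) =
    y , z ∷ zs ,
    IsPathIn-∷ Py (trans (z∷zs≋xs y) y∉) (Adj-sym G zy ∷ walk) (IsPathIn-≋ {xs} {z ∷ zs} z∷zs≋xs walk p) ,
    ≋-length {xs = z ∷ zs} {xs} z∷zs≋xs

  reverse-walk : ∀ {x xs} → Linked (Adj G) (x ∷ xs) →
    Σ (List (Fin n)) λ zs → (lastOf x xs ∷ zs) ≋ (x ∷ xs) × Linked (Adj G) (lastOf x xs ∷ zs)
  reverse-walk {x} {xs} walk with ʳ++-head x xs []
  ... | zs , eq =
    zs , subst (_≋ (x ∷ xs)) eq (ʳ++-≋ xs [ x ]) ,
    subst (Linked (Adj G)) eq (Linked-ʳ++ (Adj-sym G) walk [-])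

  no-escape⇒small-closed : ∀ {xs m} → IsPathIn xs → 1 ≤ length xs → length xs < m →
    ¬ (∃ λ z → ∃ (Escape xs z)) → SmallClosedSet G P m
  no-escape⇒small-closed {xs} p nonempty short no-escape = record
    { set      = support xs
    ; nonempty = subst (1 ≤_) (sym |support|) nonempty
    ; small    = subst (_< _) (sym |support|) short
    ; closedIn = record
      { ⊆P     = λ u u∈ → inside p u (support⇒mult xs u u∈)
      ; closed = λ u w u∈ Pw uw →
          mult⇒support xs w (no-escape⇒on-list {xs} {u} (λ (y , e) → no-escape (u , y , e))
                                                 (support⇒mult xs u u∈) w Pw uw)
      }
    }
    where
    |support| = count-support xs (distinct p)

  cycle-step : ∀ {x xs m} → IsPathIn (x ∷ xs) → length (x ∷ xs) < m → CycleThrough x xs →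
    LongerPath (x ∷ xs) ⊎ SmallClosedSet G P m
  cycle-step {x} {xs} p short (cs , cs≋ , cycle) with any? (λ z → any? (escape? (x ∷ xs) z))
  ... | no no-escape = inj₂ (no-escape⇒small-closed p (s≤s z≤n) short no-escape)
  ... | yes (z , y , esc) with mult-split z (x ∷ cs) (subst (1 ≤_) (sym (cs≋ z)) (proj₁ esc))
  ...   | As , Bs , split = inj₁ (escape⇒longer p rotated≋ (Linked-rotate As Bs cycle split) esc)
    where
    rotated≋ : (z ∷ Bs ++ As) ≋ (x ∷ xs)
    rotated≋ w = trans (++-comm-≋ (z ∷ Bs) As w) (trans (cong (mult w) (sym split)) (cs≋ w))

  module _ (d : ℕ) (min-deg : ∀ v → P v ≡ true → suc d ≤ deg G P v) where

    neighbours-on-path : ∀ {xs z} → IsPathIn xs → 1 ≤ mult z xs → ¬ ∃ (Escape xs z) →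
      suc d ≤ countᴸ (adj G z) xs
    neighbours-on-path {xs} {z} p z∈ no-escape = begin
      suc d                              ≤⟨ min-deg z (inside p z z∈) ⟩
      deg G P z                          ≤⟨ count≤countᴸ (λ u → P u ∧ adj G z u) xs on-list ⟩
      countᴸ (λ u → P u ∧ adj G z u) xs  ≤⟨ countᴸ-mono xs (λ u → ∧-conicalʳ (P u) _) ⟩
      countᴸ (adj G z) xs                ∎
      where
      open ≤-Reasoning
      on-list : ∀ u → P u ∧ adj G z u ≡ true → 1 ≤ mult u xs
      on-list u Pu∧zu =
        no-escape⇒on-list {xs} {z} no-escape z∈ u (∧-conicalˡ _ _ Pu∧zu) (∧-conicalʳ _ _ Pu∧zu)

    -- Pósa: if neither end x, z of a path shorter than 2(d + 1) has a neighbour off it, counting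
    -- their ≥ d + 1 neighbours each yields consecutive a, b on it with z ~ a and x ~ b, and then
    -- x … a z … b x is a cycle through its vertices.
    close-cycle : ∀ {x xs} → IsPathIn (x ∷ xs) → length (x ∷ xs) < 2 * suc d →
      ¬ ∃ (Escape (x ∷ xs) x) → ¬ ∃ (Escape (x ∷ xs) (lastOf x xs)) → CycleThrough x xs
    close-cycle {x} {xs} p short no-x no-z
      with consecutive-or-countᴸ≤ (adj G (lastOf x xs)) (adj G x) x xs
    ... | inj₂ bound = ⊥-elim (1+n≰n (≤-trans (≤-trans (n≤1+n _) short) too-long))
      where
      z = lastOf x xs
      too-long : 2 * suc d ≤ length xs
      too-long = begin
        2 * suc d
          ≡⟨ cong (suc d +_) (+-identityʳ (suc d)) ⟩
        suc d + suc d
          ≤⟨ +-mono-≤ (neighbours-on-path p (mult-lastOf x xs) no-z)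
                      (neighbours-on-path p (mult-head x xs) no-x) ⟩
        countᴸ (adj G z) (x ∷ xs) + countᴸ (adj G x) (x ∷ xs)
          ≤⟨ bound ⟩
        length xs + indicator (adj G x x) + indicator (adj G z z)
          ≡⟨ cong₂ (λ a b → length xs + indicator a + indicator b) (irrefl G x) (irrefl G z) ⟩
        length xs + 0 + 0
          ≡⟨ trans (+-identityʳ _) (+-identityʳ _) ⟩
        length xs ∎
        where open ≤-Reasoning
    ... | inj₁ (s , b , t , refl , za , xb) = s ++ (t ʳ++ [ b ]) , same , cycle
      where
      same : (x ∷ s ++ (t ʳ++ [ b ])) ≋ (x ∷ s ++ b ∷ t)
      same w = cong (indicator (does (w ≟ x)) +_) (++⁺-≋ s (ʳ++-≋ t [ b ]) w)
      walk-xs = walk p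
      back : Linked (Adj G) (t ʳ++ b ∷ x ∷ [])
      back = Linked-ʳ++ (Adj-sym G) (Linked-++⁻ʳ (x ∷ s) walk-xs) (Adj-sym G xb ∷ [-])
      zs = proj₁ (ʳ++-head b t (x ∷ []))
      back≡ : t ʳ++ b ∷ x ∷ [] ≡ lastOf b t ∷ zs
      back≡ = proj₂ (ʳ++-head b t (x ∷ []))
      az : Adj G (lastOf x s) (lastOf b t)
      az = Adj-sym G (subst (λ v → adj G v (lastOf x s) ≡ true) (lastOf-++ x s b t) za)
      cycle : Linked (Adj G) (x ∷ (s ++ (t ʳ++ [ b ])) ++ [ x ])
      cycle = subst (λ l → Linked (Adj G) (x ∷ l)) (sym shape)
        (Linked-++⁺ (Linked-++⁻ˡ (x ∷ s) walk-xs) az (subst (Linked (Adj G)) back≡ back))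
        where
        shape : (s ++ (t ʳ++ [ b ])) ++ [ x ] ≡ s ++ lastOf b t ∷ zs
        shape = trans (++-assoc s (t ʳ++ [ b ]) [ x ])
                      (cong (s ++_) (trans (ʳ++-assoc t [ b ] [ x ]) back≡))

    extend-or-close : ∀ {x xs} → IsPathIn (x ∷ xs) → length (x ∷ xs) < 2 * suc d →
      LongerPath (x ∷ xs) ⊎ SmallClosedSet G P (2 * suc d)
    extend-or-close {x} {xs} p short with any? (escape? (x ∷ xs) x)
    ... | yes (_ , esc) = inj₁ (escape⇒longer p (λ _ → refl) (walk p) esc)
    ... | no no-x with any? (escape? (x ∷ xs) (lastOf x xs))
    ...   | yes (_ , esc) =
      let (_ , rev≋ , rev-walk) = reverse-walk (walk p) in inj₁ (escape⇒longer p rev≋ rev-walk esc)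
    ...   | no no-z = cycle-step p short (close-cycle p short no-x no-z)

    grow : ∀ f {x xs} → length (x ∷ xs) + f ≡ 2 * suc d → IsPathIn (x ∷ xs) →
      HasPath G (2 * suc d) ⊎ SmallClosedSet G P (2 * suc d)
    grow zero    {x} {xs} len p =
      inj₁ (subst (HasPath G) (trans (sym (+-identityʳ _)) len) (Linked⇒HasPath G (walk p) (distinct p)))
    grow (suc f) {x} {xs} len p with extend-or-close p (subst (length (x ∷ xs) <_) len (m<m+n _ (s≤s z≤n)))
    ... | inj₁ (_ , ys , p′ , |ys|) =
      grow f (trans (cong (λ l → suc l + f) |ys|) (trans (sym (+-suc _ f)) len)) p′
    ... | inj₂ small = inj₂ small

    long-path-or-small-closed : ∀ v → P v ≡ true → HasPath G (2 * suc d) ⊎ SmallClosedSet G P (2 * suc d)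
    long-path-or-small-closed v Pv =
      grow (d + suc d) (cong (λ m → suc (d + suc m)) (sym (+-identityʳ d)))
           (IsPathIn-∷ Pv refl [-] IsPathIn-[])

-- Erdős–Gallai

module _ {n : ℕ} (G : Graph n) (d : ℕ) (no-path : ¬ HasPath G (2 * suc d)) where

  erdős-gallai : ∀ P → degreeSum G P ≤ count P * (2 * d)
  erdős-gallai = count-induction _ bound
    where
    bound : ∀ P → (∀ {Q} → count Q < count P → degreeSum G Q ≤ count Q * (2 * d)) →
      degreeSum G P ≤ count P * (2 * d)
    bound P rec with any? (λ v → (P v Bool.≟ true) ×-dec (deg G P v ≤? d))
    ... | yes (v , Pv , low) = begin
      degreeSum G P                                ≤⟨ degreeSum-delete≤ G P v d Pv low ⟩
      degreeSum G (delete P v) + 2 * d             ≤⟨ +-monoˡ-≤ (2 * d) (rec (≤-reflexive (sym |P|))) ⟩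
      count (delete P v) * (2 * d) + 2 * d         ≡⟨ +-comm (count (delete P v) * (2 * d)) (2 * d) ⟩
      suc (count (delete P v)) * (2 * d)           ≡⟨ cong (_* (2 * d)) |P| ⟨
      count P * (2 * d)                            ∎
      where
      open ≤-Reasoning
      |P| = count-delete-∈ P v Pv
    ... | no no-low with any? (λ v → P v Bool.≟ true)
    ...   | no empty = degreeSum≤ G P (2 * d) (λ v Pv → ⊥-elim (empty (v , Pv)))
    ...   | yes (v , Pv) with Pósa.long-path-or-small-closed G P d high v Pv
      where
      high : ∀ v → P v ≡ true → suc d ≤ deg G P v
      high v Pv = ≰⇒> (λ low → no-low (v , Pv , low))
    ...     | inj₁ path  = ⊥-elim (no-path path)
    ...     | inj₂ S = begin
      degreeSum G P                                    ≡⟨ degreeSum-split G closedIn ⟩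
      degreeSum G T + degreeSum G (P ∖ T)              ≤⟨ +-mono-≤ (degreeSum≤ G T _ deg≤) (rec rest<) ⟩
      count T * (2 * d) + count (P ∖ T) * (2 * d)      ≡⟨ *-distribʳ-+ (2 * d) (count T) _ ⟨
      (count T + count (P ∖ T)) * (2 * d)              ≡⟨ cong (_* (2 * d)) |P| ⟨
      count P * (2 * d)                                ∎
      where
      open ≤-Reasoning
      open SmallClosedSet S renaming (set to T)
      |P| = count-∖ (ClosedIn.⊆P closedIn)
      rest< : count (P ∖ T) < count P
      rest< = subst (count (P ∖ T) <_) (sym |P|) (+-monoˡ-≤ (count (P ∖ T)) nonempty)
      deg≤ : ∀ v → T v ≡ true → deg G T v ≤ 2 * d
      deg≤ v Tv = ≤-pred (≤-pred (subst (suc (suc (deg G T v)) ≤_) (cong suc (+-suc d (d + 0)))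
                                         (≤-trans (s≤s (deg<count G T v Tv)) small)))

-- Peeling off vertices of small degree

module _ {n : ℕ} (G : Graph n) (c : ℕ) where

  record Peeling (P : Fin n → Bool) : Set where
    field
      core           : Fin n → Bool
      removed        : ℕ
      core-min-deg   : ∀ v → core v ≡ true → suc c ≤ deg G core v
      count-core     : count core + removed ≡ count P
      degreeSum-core : degreeSum G P ≤ degreeSum G core + removed * (2 * c)

  peel : ∀ P → Peeling P
  peel = count-induction Peeling step
    where
    step : ∀ P → (∀ {Q} → count Q < count P → Peeling Q) → Peeling P
    step P rec with any? (λ v → (P v Bool.≟ true) ×-dec (deg G P v ≤? c))
    ... | no no-low = record
      { core           = P
      ; removed        = 0
      ; core-min-deg   = λ v Pv → ≰⇒> (λ low → no-low (v , Pv , low))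
      ; count-core     = +-identityʳ (count P)
      ; degreeSum-core = ≤-reflexive (sym (+-identityʳ _))
      }
    ... | yes (v , Pv , low) = record
      { core           = core
      ; removed        = suc removed
      ; core-min-deg   = core-min-deg
      ; count-core     = trans (+-suc (count core) removed) (trans (cong suc count-core) (sym |P|))
      ; degreeSum-core = begin
          degreeSum G P                                   ≤⟨ degreeSum-delete≤ G P v c Pv low ⟩
          degreeSum G (delete P v) + 2 * c                ≤⟨ +-monoˡ-≤ (2 * c) degreeSum-core ⟩
          degreeSum G core + removed * (2 * c) + 2 * c    ≡⟨ +-assoc (degreeSum G core) _ _ ⟩
          degreeSum G core + (removed * (2 * c) + 2 * c)  ≡⟨ cong (degreeSum G core +_) (+-comm _ (2 * c)) ⟩
          degreeSum G core + suc removed * (2 * c)        ∎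
      }
      where
      open ≤-Reasoning
      |P| = count-delete-∈ P v Pv
      open Peeling (rec (≤-reflexive (sym |P|)))

module _ {n : ℕ} (G : Graph n) (P : Fin n → Bool) where

  ∈-tabulate : ∀ {v} → v ∈ₛ tabulate P → P v ≡ true
  ∈-tabulate {v} v∈ = trans (sym (lookup∘tabulate P v)) ([]=⇒lookup v∈)

  degIn-tabulate : ∀ v → degIn G (tabulate P) v ≡ deg G P v
  degIn-tabulate v = count-cong (λ u → cong (_∧ adj G v u) (lookup∘tabulate P u))

∣tabulate∣ : ∀ {n} (P : Fin n → Bool) → ∣ tabulate P ∣ ≡ count P
∣tabulate∣ {zero}  P = refl
∣tabulate∣ {suc n} P with P fz
... | true  = cong suc (∣tabulate∣ (P ∘ fs))
... | false = ∣tabulate∣ (P ∘ fs)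

-≤⇒≤+ : ∀ {i j k : ℤ} → i ℤ.- j ℤ.≤ k → i ℤ.≤ k ℤ.+ j
-≤⇒≤+ {i} {j} {k} i-j≤k = subst (ℤ._≤ k ℤ.+ j) (cancel i j) (ℤₚ.+-monoˡ-≤ j i-j≤k)
  where
  cancel : ∀ i j → i ℤ.- j ℤ.+ j ≡ i
  cancel = ℤ-Solver.solve-∀

≤+⇒-≤ : ∀ {i j k : ℤ} → i ℤ.≤ k ℤ.+ j → i ℤ.- j ℤ.≤ k
≤+⇒-≤ {i} {j} {k} i≤k+j = subst (i ℤ.- j ℤ.≤_) (cancel k j) (ℤₚ.+-monoˡ-≤ (ℤ.- j) i≤k+j)
  where
  cancel : ∀ k j → k ℤ.+ j ℤ.- j ≡ k
  cancel = ℤ-Solver.solve-∀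

excess : ℕ → ℤ
excess k = ℤ.+ k ℤ.* ℤ.+ k ℤ.- ℤ.+ k ℤ.- ℤ.+ 1

excess≡ : ∀ j → excess (suc (suc j)) ≡ ℤ.+ (j * (3 + j) + 1)
excess≡ j = trans (poly (ℤ.+ j)) (cong (ℤ._+ ℤ.+ 1) (sym (ℤₚ.pos-* j (3 + j))))
  where
  poly : ∀ J → (ℤ.+ 2 ℤ.+ J) ℤ.* (ℤ.+ 2 ℤ.+ J) ℤ.- (ℤ.+ 2 ℤ.+ J) ℤ.- ℤ.+ 1 ≡ J ℤ.* (ℤ.+ 3 ℤ.+ J) ℤ.+ ℤ.+ 1
  poly = ℤ-Solver.solve-∀

removed≤excess : ∀ j q r e b → e + e ≤ q * (2 * suc j) + r * (2 * j) → suc j * (q + r) ≤ e + b → r ≤ b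
removed≤excess j q r e b 2e≤ hyp = +-cancelˡ-≤ X r b $ begin
  X + r            ≡⟨ expand j q r ⟩
  suc j * (q + r)  ≤⟨ hyp ⟩
  e + b            ≤⟨ +-monoˡ-≤ b e≤X ⟩
  X + b            ∎
  where
  open ≤-Reasoning
  X = q * suc j + r * j
  expand : ∀ j q r → (q * suc j + r * j) + r ≡ suc j * (q + r)
  expand = solve-∀
  twice : ∀ e → e + e ≡ 2 * e
  twice = solve-∀
  factor : ∀ j q r → q * (2 * suc j) + r * (2 * j) ≡ 2 * (q * suc j + r * j)
  factor = solve-∀
  e≤X : e ≤ X
  e≤X = *-cancelˡ-≤ 2 (subst₂ _≤_ (twice e) (factor j q r) 2e≤)

n-excess≤core : ∀ j {n q r e} → q + r ≡ n → e + e ≤ q * (2 * suc j) + r * (2 * j) →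
  ℤ.+ suc j ℤ.* ℤ.+ n ℤ.- excess (suc (suc j)) ℤ.≤ ℤ.+ e →
  ℤ.+ n ℤ.- excess (suc (suc j)) ℤ.≤ ℤ.+ q
n-excess≤core j {q = q} {r} {e} refl 2e≤ hyp =
  subst (λ x → ℤ.+ (q + r) ℤ.- x ℤ.≤ ℤ.+ q) (sym (excess≡ j)) (≤+⇒-≤ {j = ℤ.+ b} (ℤ.+≤+ (+-monoʳ-≤ q r≤b)))
  where
  b = j * (3 + j) + 1
  hyp′ : ℤ.+ (suc j * (q + r)) ℤ.- ℤ.+ b ℤ.≤ ℤ.+ e
  hyp′ = subst₂ (λ a x → a ℤ.- x ℤ.≤ ℤ.+ e) (sym (ℤₚ.pos-* (suc j) (q + r))) (excess≡ j) hyp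
  r≤b : r ≤ b
  r≤b = removed≤excess j q r e b 2e≤ (ℤₚ.drop‿+≤+ (-≤⇒≤+ {j = ℤ.+ b} hyp′))

edgeless : ∀ {n} (G : Graph n) → ¬ HasPath G 2 → edges G ≡ 0
edgeless {n} G no-path = n≤0⇒n≡0 $ begin
  edges G                    ≤⟨ m≤m+n (edges G) (edges G) ⟩
  edges G + edges G          ≡⟨ handshake G ⟩
  degreeSum G (λ _ → true)   ≤⟨ erdős-gallai G 0 no-path (λ _ → true) ⟩
  count {n} (λ _ → true) * 0 ≡⟨ *-zeroʳ (count {n} (λ _ → true)) ⟩
  0                          ∎
  where open ≤-Reasoning

lemma10 : (k : ℕ) → 1 ≤ k → (n : ℕ) → (G : Graph n) →
    ((ℤ.+ k ℤ.- ℤ.+ 1) ℤ.* ℤ.+ n ℤ.- (ℤ.+ k ℤ.* ℤ.+ k ℤ.- ℤ.+ k ℤ.- ℤ.+ 1) ℤ.≤ ℤ.+ edges G) →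
    ¬ HasPath G (2 * k) →
    Σ (Subset n) λ S →
      MinDegIn≥ G S (k ∸ 1) × (ℤ.+ n ℤ.- (ℤ.+ k ℤ.* ℤ.+ k ℤ.- ℤ.+ k ℤ.- ℤ.+ 1) ℤ.≤ ℤ.+ ∣ S ∣)
lemma10 (suc zero) _ n G hyp no-path = ⊥-elim (1+n≰n (subst (1 ≤_) (edgeless G no-path) (ℤₚ.drop‿+≤+ hyp)))
lemma10 (suc (suc j)) _ n G hyp no-path = tabulate core , min-degree , size
  where
  open Peeling (peel G j (λ _ → true))
  min-degree : MinDegIn≥ G (tabulate core) (suc j)
  min-degree v v∈ = subst (suc j ≤_) (sym (degIn-tabulate G core v)) (core-min-deg v (∈-tabulate G core v∈))
  twice-edges≤ : edges G + edges G ≤ count core * (2 * suc j) + removed * (2 * j)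
  twice-edges≤ = begin
    edges G + edges G                             ≡⟨ handshake G ⟩
    degreeSum G (λ _ → true)                      ≤⟨ degreeSum-core ⟩
    degreeSum G core + removed * (2 * j)          ≤⟨ +-monoˡ-≤ _ (erdős-gallai G (suc j) no-path core) ⟩
    count core * (2 * suc j) + removed * (2 * j)  ∎
    where open ≤-Reasoning
  size : ℤ.+ n ℤ.- excess (suc (suc j)) ℤ.≤ ℤ.+ ∣ tabulate core ∣
  size = subst (λ c → ℤ.+ n ℤ.- excess (suc (suc j)) ℤ.≤ ℤ.+ c) (sym (∣tabulate∣ core))
               (n-excess≤core j (trans count-core count-all) twice-edges≤ hyp)
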